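{- Let $T_1,\dots,T_k$ be subtrees of a tree $T$ such that $T=T_1\cup\dots\cup T_k$. Then $\operatorname{pw}(T)+1\le\sum_{i=1}^k(\operatorname{pw}(T_i)+1)$.
   Context: $\operatorname{pw}$ denotes pathwidth: the minimum, over path decompositions (sequences of vertex subsets such that every edge lies in some bag and each vertex's bags form a non-empty consecutive interval), of the maximum bag size minus 1. Subtrees are connected subgraphs of $T$. -}

module Defs where

open import Data.Nat using (ℕ; _∸_; _⊔_; _≤_)
open import Data.Fin using (Fin) renaming (_≤_ to _≤ᶠ_)
open import Data.Fin.Subset using (Subset; _∈_; ∣_∣)
open import Data.List using (List; []; _∷_; _++_; [_]; length; tabulate; foldr)
open import Data.List.Relation.Unary.Linked using (Linked)
open import Data.List.Relation.Unary.Unique.Propositional using (Unique)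
open import Data.Product using (Σ; ∃; _×_)
open import Relation.Nullary using (¬_)
open import Relation.Binary.PropositionalEquality using (_≡_)

record Graph (n : ℕ) : Set₁ where
  field
    V     : Subset n
    E     : Fin n → Fin n → Set
    E-sym : ∀ {u v} → E u v → E v u
    E-irr : ∀ {u} → ¬ E u u
    E-V   : ∀ {u v} → E u v → u ∈ V
open Graph public

data Walk {n : ℕ} (G : Graph n) : Fin n → Fin n → Set where
  stay : ∀ {u} → u ∈ V G → Walk G u u
  step : ∀ {u w v} → E G u w → Walk G w v → Walk G u v

Connected : ∀ {n} → Graph n → Set
Connected G = (∃ λ v → v ∈ V G) × (∀ u v → u ∈ V G → v ∈ V G → Walk G u v)

-- A cycle: distinct vertices u, m₁, …, mₗ, w (l ≥ 1, so ≥ 3 vertices),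
-- consecutive ones adjacent, and w adjacent to u.
HasCycle : ∀ {n} → Graph n → Set
HasCycle {n} G =
  Σ (Fin n) λ u → Σ (Fin n) λ w → Σ (List (Fin n)) λ mid →
    (1 ≤ length mid) × Unique (u ∷ mid ++ [ w ]) ×
    Linked (E G) (u ∷ mid ++ [ w ]) × E G w u

IsTree : ∀ {n} → Graph n → Set
IsTree G = Connected G × ¬ HasCycle G

IsSubgraph : ∀ {n} → Graph n → Graph n → Set
IsSubgraph H G = (∀ v → v ∈ V H → v ∈ V G) × (∀ u v → E H u v → E G u v)

IsSubtree : ∀ {n} → Graph n → Graph n → Set
IsSubtree H T = IsSubgraph H T × Connected H

-- G is contained in the union of the Hs (with IsSubgraph this gives G = ⋃ Hs)
CoveredBy : ∀ {n k} → Graph n → (Fin k → Graph n) → Set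
CoveredBy G Hs =
  (∀ v → v ∈ V G → ∃ λ i → v ∈ V (Hs i)) ×
  (∀ u v → E G u v → ∃ λ i → E (Hs i) u v)

record PathDecomposition {n : ℕ} (G : Graph n) : Set where
  field
    len        : ℕ
    bag        : Fin len → Subset n
    bag⊆V      : ∀ i v → v ∈ bag i → v ∈ V G
    edge-cov   : ∀ u v → E G u v → ∃ λ i → u ∈ bag i × v ∈ bag i
    vertex-cov : ∀ v → v ∈ V G → ∃ λ i → v ∈ bag i
    interval   : ∀ v (i j l : Fin len) → i ≤ᶠ j → j ≤ᶠ l →
                 v ∈ bag i → v ∈ bag l → v ∈ bag j
open PathDecomposition public

maxBagSize : ∀ {n} {G : Graph n} → PathDecomposition G → ℕ
maxBagSize D = foldr _⊔_ 0 (tabulate (λ i → ∣ bag D i ∣))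

width : ∀ {n} {G : Graph n} → PathDecomposition G → ℕ
width D = maxBagSize D ∸ 1

IsPathwidth : ∀ {n} → Graph n → ℕ → Set
IsPathwidth G p =
  (Σ (PathDecomposition G) λ D → width D ≡ p) × (∀ (D : PathDecomposition G) → p ≤ width D)

-- If two subtrees A and B of a tree meet, every component of A − B is attached to B at a
-- single vertex, its anchor: two different attachment points would close a cycle with a
-- path inside B. Path decompositions of A and B therefore combine into one of A ∪ B: replace
-- the j-th bag of B's decomposition by the sequence of A's bags, each restricted to the
-- vertices of A − B whose anchor was assigned to bag j and joined with bag j. Its bags have
-- at most (max bag of A) + (max bag of B) vertices. Since T is connected, the first subtree
-- meets another one; merging the two and recursing gives a decomposition of T whose bags
-- have at most Σᵢ (pw(Tᵢ) + 1) vertices.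

module Submission where

open import Data.Bool using (true; false)
open import Data.Empty using (⊥; ⊥-elim)
open import Data.Fin using (Fin; zero; suc; toℕ; combine; quotient; remainder)
  renaming (_≤_ to _≤ᶠ_; _<_ to _<ᶠ_)
import Data.Fin.Properties as Finₚ
open Finₚ using (_≟_)
open import Data.Fin.Subset using (Subset; _∈_; _∉_; _∪_; _∩_; ∣_∣; Nonempty)
import Data.Fin.Subset.Properties as Subset
open import Data.List using (List; []; _∷_; _++_; [_]; length; tabulate)
import Data.List.Properties as List
open import Data.List.Membership.Propositional using () renaming (_∈_ to _∈ₗ_; _∉_ to _∉ₗ_)
import Data.List.Membership.Propositional.Properties as ∈ₗ
import Data.List.Membership.DecPropositional as DecMembership
open import Data.List.Relation.Binary.Subset.Propositional using (_⊆_)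
import Data.List.Relation.Binary.Subset.Propositional.Properties as ⊆
open import Data.List.Relation.Unary.All as All using (All; []; _∷_)
import Data.List.Relation.Unary.All.Properties as All
open import Data.List.Relation.Unary.AllPairs using ([]; _∷_)
open import Data.List.Relation.Unary.Any using (here; there)
open import Data.List.Relation.Unary.Linked using (Linked; [-]; _∷_)
open import Data.List.Relation.Unary.Unique.Propositional using (Unique)
import Data.List.Relation.Unary.Unique.Propositional.Properties as Unique
open import Data.Nat using (ℕ; zero; suc; _+_; _*_; _∸_; _≤_; _⊔_; s≤s; z≤n)
import Data.Nat.Properties as ℕ
open import Algebra.Properties.CommutativeSemigroup ℕ.+-commutativeSemigroup using (x∙yz≈y∙xz)
open import Data.Nat.ListAction using (sum)
open import Data.Product using (Σ; ∃; ∃₂; _×_; _,_; proj₁; proj₂)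
import Data.Product as Product
open import Data.Sum using (_⊎_; inj₁; inj₂; [_,_]′)
import Data.Sum as Sum
open import Data.Vec as Vec using (_∷_)
import Data.Vec.Properties as Vec
open import Data.Vec.Functional using (Vector; updateAt)
import Data.Vec.Functional.Properties as Vectorₚ
open import Function using (_∘_)
open import Relation.Binary.Definitions using (DecidableEquality)
open import Relation.Binary.PropositionalEquality using (_≡_; refl; sym; trans; cong; subst; subst₂)
open import Relation.Nullary using (¬_; Dec; yes; no; does; ¬?; _×-dec_)
open import Relation.Nullary.Decidable using (dec-true)
open import Relation.Unary using (Decidable)

open import Defs

module _ {A : Set} where

  -- An R-path from u to v; the list records its vertices except the last one.
  data Chain (R : A → A → Set) : A → A → List A → Set where
    []  : ∀ {u} → Chain R u u []
    _∷_ : ∀ {u w v xs} → R u w → Chain R w v xs → Chain R u v (u ∷ xs)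

  module _ {R : A → A → Set} where

    chain-map : ∀ {S : A → A → Set} → (∀ {a b} → R a b → S a b) →
                ∀ {u v xs} → Chain R u v xs → Chain S u v xs
    chain-map f []      = []
    chain-map f (e ∷ c) = f e ∷ chain-map f c

    chain-sources : ∀ {P : A → Set} → (∀ {a b} → R a b → P a) →
                    ∀ {u v xs} → Chain R u v xs → All P xs
    chain-sources f []      = []
    chain-sources f (e ∷ c) = f e ∷ chain-sources f c

    _++ᶜ_ : ∀ {u w v xs ys} → Chain R u w xs → Chain R w v ys → Chain R u v (xs ++ ys)
    []      ++ᶜ d = d
    (e ∷ c) ++ᶜ d = e ∷ (c ++ᶜ d)

    chain-linked : ∀ {u v xs} → Chain R u v xs → Linked R (xs ++ [ v ])
    chain-linked []                = [-]
    chain-linked (e ∷ [])          = e ∷ [-]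
    chain-linked (e ∷ c@(_ ∷ _))   = e ∷ chain-linked c

    chain-unsnoc : ∀ {u v x xs} → Chain R u v (x ∷ xs) →
                   ∃₂ λ ys w → x ∷ xs ≡ ys ++ [ w ] × Chain R u w ys × R w v
    chain-unsnoc (e ∷ [])        = [] , _ , refl , [] , e
    chain-unsnoc (e ∷ c@(_ ∷ _)) with ys , w , eq , c′ , e′ ← chain-unsnoc c =
      _ ∷ ys , w , cong (_ ∷_) eq , e ∷ c′ , e′

    chain-head∈ : ∀ {w v xs} → Chain R w v xs → w ∈ₗ v ∷ xs
    chain-head∈ []      = here refl
    chain-head∈ (_ ∷ _) = there (here refl)

    chain-reverse : (∀ {a b} → R a b → R b a) →
                    ∀ {u v xs} → Chain R u v xs → ∃ λ ys → Chain R v u ys × ys ⊆ v ∷ xs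
    chain-reverse sym-R []      = [] , [] , λ ()
    chain-reverse sym-R {u} {v} (_∷_ {w = w} {xs = xs} e c)
      with ys , c′ , ys⊆ ← chain-reverse sym-R c =
      ys ++ [ w ] , c′ ++ᶜ (sym-R e ∷ []) , ⊆.∷⁺ʳ v (⊆.xs⊆x∷xs xs u) ∘ ⊆-v∷xs
      where
      ⊆-v∷xs : ys ++ [ w ] ⊆ v ∷ xs
      ⊆-v∷xs y∈ with ∈ₗ.∈-++⁻ ys y∈
      ... | inj₁ y∈ys        = ys⊆ y∈ys
      ... | inj₂ (here refl) = chain-head∈ c

    chain-suffix : ∀ {w v u} pre {post} → Chain R w v (pre ++ u ∷ post) → Chain R u v (u ∷ post)
    chain-suffix []        c@(_ ∷ _) = c
    chain-suffix (_ ∷ pre) (_ ∷ c)   = chain-suffix pre c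

  unique-++⁻ʳ : ∀ pre {ys : List A} → Unique (pre ++ ys) → Unique ys
  unique-++⁻ʳ []        u       = u
  unique-++⁻ʳ (_ ∷ pre) (_ ∷ u) = unique-++⁻ʳ pre u

  module _ (_≟ᴬ_ : DecidableEquality A) {R : A → A → Set} where
    open DecMembership _≟ᴬ_ using () renaming (_∈?_ to _∈ₗ?_)

    chain-shorten : ∀ {u v xs} → Chain R u v xs →
                    ∃ λ ys → Chain R u v ys × Unique ys × v ∉ₗ ys × ys ⊆ xs
    chain-shorten [] = [] , [] , [] , (λ ()) , λ ()
    chain-shorten {u} {v} (e ∷ c) with u ≟ᴬ v
    ... | yes refl = [] , [] , [] , (λ ()) , λ ()
    ... | no u≢v with ys , c′ , ys-unique , v∉ys , ys⊆xs ← chain-shorten c with u ∈ₗ? ys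
    ...   | no u∉ys =
      u ∷ ys , e ∷ c′ , All.¬Any⇒All¬ ys u∉ys ∷ ys-unique ,
      (λ { (here v≡u) → u≢v (sym v≡u) ; (there v∈ys) → v∉ys v∈ys }) ,
      ⊆.∷⁺ʳ u ys⊆xs
    ...   | yes u∈ys with pre , post , refl ← ∈ₗ.∈-∃++ u∈ys =
      u ∷ post , chain-suffix pre c′ , unique-++⁻ʳ pre ys-unique ,
      v∉ys ∘ ∈ₗ.∈-++⁺ʳ pre , there ∘ ys⊆xs ∘ ∈ₗ.∈-++⁺ʳ pre

1≤length-++-∷ : ∀ {A : Set} (xs : List A) {y ys} → 1 ≤ length (xs ++ y ∷ ys)
1≤length-++-∷ []      = s≤s z≤n
1≤length-++-∷ (_ ∷ _) = s≤s z≤n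

module _ {n : ℕ} {P : Fin n → Set} (P? : Decidable P) where

  select : Subset n
  select = Vec.tabulate (does ∘ P?)

  ∈-select⁺ : ∀ {x} → P x → x ∈ select
  ∈-select⁺ {x} px =
    Vec.lookup⇒[]= x select (trans (Vec.lookup∘tabulate (does ∘ P?) x) (dec-true (P? x) px))

  ∈-select⁻ : ∀ {x} → x ∈ select → P x
  ∈-select⁻ {x} x∈ with P? x | trans (sym (Vec.lookup∘tabulate (does ∘ P?) x)) (Vec.[]=⇒lookup x∈)
  ... | yes px | _  = px
  ... | no _   | ()

∣p∪q∣≤∣p∣+∣q∣ : ∀ {n} (p q : Subset n) → ∣ p ∪ q ∣ ≤ ∣ p ∣ + ∣ q ∣
∣p∪q∣≤∣p∣+∣q∣ Vec.[]      Vec.[]      = z≤n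
∣p∪q∣≤∣p∣+∣q∣ (true  ∷ p) (true  ∷ q) =
  s≤s (ℕ.≤-trans (∣p∪q∣≤∣p∣+∣q∣ p q) (ℕ.+-monoʳ-≤ ∣ p ∣ (ℕ.n≤1+n _)))
∣p∪q∣≤∣p∣+∣q∣ (true  ∷ p) (false ∷ q) = s≤s (∣p∪q∣≤∣p∣+∣q∣ p q)
∣p∪q∣≤∣p∣+∣q∣ (false ∷ p) (true  ∷ q) =
  subst (suc ∣ p ∪ q ∣ ≤_) (sym (ℕ.+-suc ∣ p ∣ ∣ q ∣)) (s≤s (∣p∪q∣≤∣p∣+∣q∣ p q))
∣p∪q∣≤∣p∣+∣q∣ (false ∷ p) (false ∷ q) = ∣p∪q∣≤∣p∣+∣q∣ p q

module _ {m : ℕ} (k : ℕ) where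

  toℕ-quotient-remainder : ∀ (t : Fin (m * k)) →
                           toℕ t ≡ k * toℕ (quotient {m} k t) + toℕ (remainder {m} k t)
  toℕ-quotient-remainder t = trans (cong toℕ (sym (Finₚ.combine-remQuot {m} k t)))
                                   (Finₚ.toℕ-combine (quotient {m} k t) (remainder {m} k t))

  quotient-mono : ∀ {t t′ : Fin (m * k)} → t ≤ᶠ t′ → quotient {m} k t ≤ᶠ quotient {m} k t′
  quotient-mono {t} {t′} t≤t′ = ℕ.≮⇒≥ λ q′<q → ℕ.<⇒≱ (t′<t q′<q) t≤t′
    where
    t′<t : quotient {m} k t′ <ᶠ quotient {m} k t → t′ <ᶠ t
    t′<t q′<q = subst₂ _<ᶠ_ (Finₚ.combine-remQuot {m} k t′) (Finₚ.combine-remQuot {m} k t)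
                  (Finₚ.combine-monoˡ-< (remainder {m} k t′) (remainder {m} k t) q′<q)

  remainder-mono : ∀ {t t′ : Fin (m * k)} → quotient {m} k t ≡ quotient {m} k t′ → t ≤ᶠ t′ →
                   remainder {m} k t ≤ᶠ remainder {m} k t′
  remainder-mono {t} {t′} q≡q′ t≤t′ = ℕ.+-cancelˡ-≤ (k * toℕ (quotient {m} k t)) _ _
    (subst₂ _≤_ (toℕ-quotient-remainder t)
      (trans (toℕ-quotient-remainder t′) (cong (λ j → k * toℕ j + toℕ (remainder {m} k t′)) (sym q≡q′)))
      t≤t′)

sum-tabulate-mono : ∀ {k} {f g : Fin k → ℕ} → (∀ i → f i ≤ g i) → sum (tabulate f) ≤ sum (tabulate g)
sum-tabulate-mono {zero}  f≤g = z≤n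
sum-tabulate-mono {suc k} f≤g = ℕ.+-mono-≤ (f≤g zero) (sum-tabulate-mono (f≤g ∘ suc))

sum-tabulate-updateAt-≤ : ∀ {a} {A : Set a} {k} (g : A → ℕ) (xs : Vector A k) j (f : A → A) c →
                          g (f (xs j)) ≤ c + g (xs j) →
                          sum (tabulate (g ∘ updateAt xs j f)) ≤ c + sum (tabulate (g ∘ xs))
sum-tabulate-updateAt-≤ g xs zero f c f≤ =
  ℕ.≤-trans (ℕ.+-monoˡ-≤ _ f≤) (ℕ.≤-reflexive (ℕ.+-assoc c (g (xs zero)) _))
sum-tabulate-updateAt-≤ g xs (suc j) f c f≤ =
  ℕ.≤-trans (ℕ.+-monoʳ-≤ (g (xs zero)) (sum-tabulate-updateAt-≤ g (xs ∘ suc) j f c f≤))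
            (ℕ.≤-reflexive (x∙yz≈y∙xz (g (xs zero)) c _))

m∸n+n≤m⊔n : ∀ m n → m ∸ n + n ≤ m ⊔ n
m∸n+n≤m⊔n m n with n ℕ.≤? m
... | yes n≤m = ℕ.≤-trans (ℕ.≤-reflexive (ℕ.m∸n+n≡m n≤m)) (ℕ.m≤m⊔n m n)
... | no n≰m  = subst (λ d → d + n ≤ m ⊔ n) (sym (ℕ.m≤n⇒m∸n≡0 (ℕ.≰⇒≥ n≰m))) (ℕ.m≤n⊔m m n)

_∪ᴳ_ : ∀ {n} → Graph n → Graph n → Graph n
G ∪ᴳ H = record
  { V     = V G ∪ V H
  ; E     = λ u v → E G u v ⊎ E H u v
  ; E-sym = Sum.map (E-sym G) (E-sym H)
  ; E-irr = [ E-irr G , E-irr H ]′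
  ; E-V   = Subset.x∈p∪q⁺ ∘ Sum.map (E-V G) (E-V H)
  }

module _ {n : ℕ} where

  walk-map : ∀ {G H : Graph n} → IsSubgraph G H → ∀ {u v} → Walk G u v → Walk H u v
  walk-map (V⊆ , _)       (stay u∈)  = stay (V⊆ _ u∈)
  walk-map G⊆H@(_ , E⊆) (step e w) = step (E⊆ _ _ e) (walk-map G⊆H w)

  _++ʷ_ : ∀ {G : Graph n} {u w v} → Walk G u w → Walk G w v → Walk G u v
  stay _   ++ʷ w′ = w′
  step e w ++ʷ w′ = step e (w ++ʷ w′)

  walk-exit : ∀ {G : Graph n} (X : Subset n) {a b} → Walk G a b → a ∈ X → b ∉ X →
              ∃₂ λ x y → E G x y × x ∈ X × y ∉ X
  walk-exit X (stay _) a∈X b∉X = ⊥-elim (b∉X a∈X)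
  walk-exit X (step {u} {w} e walk) u∈X b∉X with w Subset.∈? X
  ... | yes w∈X = walk-exit X walk w∈X b∉X
  ... | no w∉X  = u , w , e , u∈X , w∉X

  ∪ᴳ-subgraphˡ : ∀ {G H : Graph n} → IsSubgraph G (G ∪ᴳ H)
  ∪ᴳ-subgraphˡ = (λ _ → Subset.x∈p∪q⁺ ∘ inj₁) , (λ _ _ → inj₁)

  ∪ᴳ-subgraphʳ : ∀ {G H : Graph n} → IsSubgraph H (G ∪ᴳ H)
  ∪ᴳ-subgraphʳ = (λ _ → Subset.x∈p∪q⁺ ∘ inj₂) , (λ _ _ → inj₂)

  ∪ᴳ-least : ∀ {G H K : Graph n} → IsSubgraph G K → IsSubgraph H K → IsSubgraph (G ∪ᴳ H) K
  ∪ᴳ-least {G} {H} (VG⊆ , EG⊆) (VH⊆ , EH⊆) =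
    (λ v → [ VG⊆ v , VH⊆ v ]′ ∘ Subset.x∈p∪q⁻ (V G) (V H)) , (λ u v → [ EG⊆ u v , EH⊆ u v ]′)

  ∪ᴳ-connected : ∀ {G H : Graph n} {c} → Connected G → Connected H → c ∈ V G → c ∈ V H →
                 Connected (G ∪ᴳ H)
  ∪ᴳ-connected {G} {H} {c} (_ , G-walk) (_ , H-walk) c∈G c∈H =
    (c , Subset.x∈p∪q⁺ (inj₁ c∈G)) , λ u v u∈ v∈ → to-c u∈ ++ʷ from-c v∈
    where
    to-c : ∀ {u} → u ∈ V (G ∪ᴳ H) → Walk (G ∪ᴳ H) u c
    to-c u∈ = [ (λ u∈G → walk-map (∪ᴳ-subgraphˡ {G} {H}) (G-walk _ c u∈G c∈G))
              , (λ u∈H → walk-map (∪ᴳ-subgraphʳ {G} {H}) (H-walk _ c u∈H c∈H))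
              ]′ (Subset.x∈p∪q⁻ (V G) (V H) u∈)

    from-c : ∀ {v} → v ∈ V (G ∪ᴳ H) → Walk (G ∪ᴳ H) c v
    from-c v∈ = [ (λ v∈G → walk-map (∪ᴳ-subgraphˡ {G} {H}) (G-walk c _ c∈G v∈G))
                , (λ v∈H → walk-map (∪ᴳ-subgraphʳ {G} {H}) (H-walk c _ c∈H v∈H))
                ]′ (Subset.x∈p∪q⁻ (V G) (V H) v∈)

  IsSubgraph-refl : ∀ {G : Graph n} → IsSubgraph G G
  IsSubgraph-refl = (λ _ v∈ → v∈) , (λ _ _ e → e)

  coveredBy-⊆ : ∀ {k k′} {G : Graph n} {Hs : Fin k → Graph n} {Hs′ : Fin k′ → Graph n} →
                (f : Fin k → Fin k′) → (∀ i → IsSubgraph (Hs i) (Hs′ (f i))) →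
                CoveredBy G Hs → CoveredBy G Hs′
  coveredBy-⊆ f Hs⊆ (V-cov , E-cov) =
    (λ v v∈ → let (i , v∈Hᵢ) = V-cov v v∈ in f i , proj₁ (Hs⊆ i) v v∈Hᵢ) ,
    (λ u v e → let (i , e∈Hᵢ) = E-cov u v e in f i , proj₂ (Hs⊆ i) u v e∈Hᵢ)

  overlapping-piece : ∀ {k} {G : Graph n} (Hs : Fin (suc (suc k)) → Graph n) → Connected G →
                      (∀ i → IsSubgraph (Hs i) G) → (∀ i → Nonempty (V (Hs i))) → CoveredBy G Hs →
                      ∃₂ λ j x → x ∈ V (Hs zero) × x ∈ V (Hs (suc j))
  overlapping-piece Hs (_ , walk) Hs⊆G nonempty (_ , E-cov)
    with c , c∈H₀ ← nonempty zero | v , v∈H₁ ← nonempty (suc zero)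
    with v Subset.∈? V (Hs zero)
  ... | yes v∈H₀ = zero , v , v∈H₀ , v∈H₁
  ... | no v∉H₀
    with x , y , e , x∈H₀ , y∉H₀ ←
         walk-exit (V (Hs zero)) (walk c v (proj₁ (Hs⊆G zero) c c∈H₀) (proj₁ (Hs⊆G (suc zero)) v v∈H₁))
                   c∈H₀ v∉H₀
    with E-cov x y e
  ... | zero  , e∈H₀ = ⊥-elim (y∉H₀ (E-V (Hs zero) (E-sym (Hs zero) e∈H₀)))
  ... | suc j , e∈Hⱼ = j , x , x∈H₀ , E-V (Hs (suc j)) e∈Hⱼ

  sole-piece : ∀ {G : Graph n} {Hs : Fin 1 → Graph n} → CoveredBy G Hs → IsSubgraph G (Hs zero)
  sole-piece {G} {Hs} (V-cov , E-cov) = V⊆ , E⊆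
    where
    V⊆ : ∀ v → v ∈ V G → v ∈ V (Hs zero)
    V⊆ v v∈ with zero , v∈H ← V-cov v v∈ = v∈H

    E⊆ : ∀ u v → E G u v → E (Hs zero) u v
    E⊆ u v e with zero , e∈H ← E-cov u v e = e∈H

  spanning-supergraph-decomposition : ∀ {G H : Graph n} → (∀ v → v ∈ V H → v ∈ V G) →
                                      IsSubgraph G H → PathDecomposition H → PathDecomposition G
  spanning-supergraph-decomposition VH⊆VG (VG⊆VH , EG⊆EH) D = record
    { len        = len D
    ; bag        = bag D
    ; bag⊆V      = λ i v v∈ → VH⊆VG v (bag⊆V D i v v∈)
    ; edge-cov   = λ u v e → edge-cov D u v (EG⊆EH u v e)
    ; vertex-cov = λ v v∈ → vertex-cov D v (VG⊆VH v v∈)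
    ; interval   = interval D
    }

module _ {n : ℕ} {G : Graph n} (D : PathDecomposition G) where

  bag≤maxBagSize : ∀ i → ∣ bag D i ∣ ≤ maxBagSize D
  bag≤maxBagSize = All.tabulate⁻
    (List.foldr-forcesᵇ (λ x y x⊔y≤ → ℕ.m⊔n≤o⇒m≤o x y x⊔y≤ , ℕ.m⊔n≤o⇒n≤o x y x⊔y≤) 0 _ ℕ.≤-refl)

  maxBagSize-lub : ∀ {K} → (∀ i → ∣ bag D i ∣ ≤ K) → maxBagSize D ≤ K
  maxBagSize-lub {K} bag≤K = List.foldr-preservesᵇ {P = _≤ K} ℕ.⊔-lub z≤n (All.tabulate⁺ bag≤K)

maxBagSize≤width+1 : ∀ {n} {G : Graph n} (D : PathDecomposition G) → maxBagSize D ≤ width D + 1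
maxBagSize≤width+1 D = subst (maxBagSize D ≤_) (ℕ.+-comm 1 (width D)) (ℕ.m≤n+m∸n (maxBagSize D) 1)

module _ {n : ℕ} where

  walk⇒chain : ∀ {G : Graph n} {u v} → Walk G u v → ∃ λ xs → Chain (E G) u v xs
  walk⇒chain (stay _)   = [] , []
  walk⇒chain (step e w) = _ , e ∷ proj₂ (walk⇒chain w)

  acyclic-closed-chain : ∀ {G : Graph n} → ¬ HasCycle G →
                         ∀ {u zs} → Chain (E G) u u zs → Unique zs → 3 ≤ length zs → ⊥
  acyclic-closed-chain _ []           _ ()
  acyclic-closed-chain _ (_ ∷ [])     _ (s≤s ())
  acyclic-closed-chain _ (_ ∷ _ ∷ []) _ (s≤s (s≤s ()))
  acyclic-closed-chain acyclic (e ∷ c@(_ ∷ _ ∷ _)) zs-unique _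
    with mid , w , eq , c′ , e′ ← chain-unsnoc c =
    acyclic (_ , w , mid , mid-nonempty mid eq , subst Unique (cong (_ ∷_) eq) zs-unique ,
             chain-linked (e ∷ c′) , e′)
    where
    mid-nonempty : ∀ {a b rest} mid → a ∷ b ∷ rest ≡ mid ++ [ w ] → 1 ≤ length mid
    mid-nonempty []      ()
    mid-nonempty (_ ∷ _) _ = s≤s z≤n

module _ {n : ℕ} (T B : Graph n) where

  OutEdge : Fin n → Fin n → Set
  OutEdge a b = E T a b × a ∉ V B

  OffEdge : Fin n → Fin n → Set
  OffEdge a b = E T a b × (a ∉ V B ⊎ b ∉ V B)

  approach-from-B : ∀ {u x xs} → u ∈ V B → Chain OutEdge u x xs → u ≡ x
  approach-from-B u∈B []             = refl
  approach-from-B u∈B ((_ , u∉B) ∷ _) = ⊥-elim (u∉B u∈B)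

module _ {n : ℕ} {T B : Graph n} (acyclic : ¬ HasCycle T) (B⊑T : IsSubtree B T) where

  private
    E-B⇒E-T : ∀ {u v} → E B u v → E T u v
    E-B⇒E-T = proj₂ (proj₁ B⊑T) _ _

    simple-B-chain : ∀ {u v} → u ∈ V B → v ∈ V B →
                     ∃ λ ys → Chain (E B) u v ys × Unique ys × v ∉ₗ ys
    simple-B-chain u∈B v∈B
      with ys , c , ys-unique , v∉ys , _ ←
           chain-shorten _≟_ (proj₂ (walk⇒chain (proj₂ (proj₂ B⊑T) _ _ u∈B v∈B))) =
      ys , c , ys-unique , v∉ys

  subtree-induced : ∀ {u v} → u ∈ V B → v ∈ V B → E T u v → E B u v
  subtree-induced u∈B v∈B e with simple-B-chain u∈B v∈B
  ... | _ , []      , _ , _ = ⊥-elim (E-irr T e)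
  ... | _ , e′ ∷ [] , _ , _ = e′
  ... | _ ∷ _ ∷ ys , c@(_ ∷ _ ∷ _) , c-unique , v∉ =
    ⊥-elim (acyclic-closed-chain {G = T} acyclic (chain-map E-B⇒E-T c ++ᶜ (E-sym T e ∷ []))
              (Unique.++⁺ c-unique ([] ∷ []) λ { (v∈ , here refl) → v∉ v∈ })
              (s≤s (s≤s (1≤length-++-∷ ys))))

  private
    OutEdge⇒OffEdge : ∀ {a b} → OutEdge T B a b → OffEdge T B a b
    OutEdge⇒OffEdge (e , a∉B) = e , inj₁ a∉B

    OffEdge-sym : ∀ {a b} → OffEdge T B a b → OffEdge T B b a
    OffEdge-sym (e , inj₁ a∉B) = E-sym T e , inj₂ a∉B
    OffEdge-sym (e , inj₂ b∉B) = E-sym T e , inj₁ b∉B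

    no-detour : ∀ {x x′ zs} → x ∈ V B → x′ ∈ V B → Chain (OffEdge T B) x x′ (x ∷ zs) →
                Unique (x ∷ zs) → x′ ∉ₗ x ∷ zs → All (_∉ V B) zs → ⊥
    no-detour {zs = []} x∈B _    ((_ , inj₁ x∉B) ∷ [])  _ _ _ = x∉B x∈B
    no-detour {zs = []} _   x′∈B ((_ , inj₂ x′∉B) ∷ []) _ _ _ = x′∉B x′∈B
    no-detour {zs = _ ∷ zs} x∈B x′∈B P (x∉zs ∷ zs-unique) x′∉ zs∉B with simple-B-chain x′∈B x∈B
    ... | _ , []        , _ , _ = x′∉ (here refl)
    ... | _ , Q@(_ ∷ _) , Q-unique , x∉Q =
      acyclic-closed-chain {G = T} acyclic (chain-map proj₁ P ++ᶜ chain-map E-B⇒E-T Q)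
        (All.++⁺ x∉zs (All.¬Any⇒All¬ _ x∉Q) ∷ Unique.++⁺ zs-unique Q-unique
          (λ (y∈zs , y∈Q) → All.lookup zs∉B y∈zs (All.lookup (chain-sources (E-V B) Q) y∈Q)))
        (s≤s (s≤s (1≤length-++-∷ zs)))

  -- If the endpoints differed, the two approaches, glued at u and shortened, would be a
  -- detour outside B between two vertices of B, closing a cycle with a path inside B.
  approach-unique : ∀ {u x x′ xs xs′} → x ∈ V B → x′ ∈ V B →
                    Chain (OutEdge T B) u x xs → Chain (OutEdge T B) u x′ xs′ → x ≡ x′
  approach-unique {x = x} {x′} x∈B x′∈B c c′ with x ≟ x′
  ... | yes x≡x′ = x≡x′
  ... | no x≢x′
    with ys , c⁻¹ , ys⊆ ← chain-reverse OffEdge-sym (chain-map OutEdge⇒OffEdge c)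
    with chain-shorten _≟_ (c⁻¹ ++ᶜ chain-map OutEdge⇒OffEdge c′)
  ... | _ , [] , _ , _ , _ = ⊥-elim (x≢x′ refl)
  ... | _ ∷ zs , P@(_ ∷ _) , P-unique@(x∉zs ∷ _) , x′∉P , P⊆ =
    ⊥-elim (no-detour x∈B x′∈B P P-unique x′∉P (All.tabulate outside))
    where
    outside : ∀ {y} → y ∈ₗ zs → y ∉ V B
    outside y∈zs with ∈ₗ.∈-++⁻ ys (P⊆ (there y∈zs))
    ... | inj₂ y∈xs′ = All.lookup (chain-sources proj₂ c′) y∈xs′
    ... | inj₁ y∈ys with ys⊆ y∈ys
    ...   | here refl  = ⊥-elim (All.lookup x∉zs y∈zs refl)
    ...   | there y∈xs = All.lookup (chain-sources proj₂ c) y∈xs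

-- Every component of A − B hangs off B at a single vertex, its anchor.
record Attachment {n : ℕ} (A B : Graph n) : Set where
  field
    anchor        : Fin n → Fin n
    anchor-fixed  : ∀ {v} → v ∈ V B → anchor v ≡ v
    anchor-step   : ∀ {u v} → E A u v → u ∉ V B → anchor u ≡ anchor v
    edge-induced  : ∀ {u v} → E A u v → u ∈ V B → v ∈ V B → E B u v

module _ {n : ℕ} {T B : Graph n} (tree : IsTree T) (B⊑T : IsSubtree B T) where

  private
    b₀ : Fin n
    b₀ = proj₁ (proj₁ (proj₂ B⊑T))

    b₀∈B : b₀ ∈ V B
    b₀∈B = proj₂ (proj₁ (proj₂ B⊑T))

  approach-along : ∀ {u v} → Walk T u v → v ∈ V B → ∃ λ x → x ∈ V B × ∃ (Chain (OutEdge T B) u x)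
  approach-along (stay _) v∈B = _ , v∈B , [] , []
  approach-along (step {u} e w) v∈B with u Subset.∈? V B
  ... | yes u∈B = u , u∈B , [] , []
  ... | no u∉B with x , x∈B , xs , c ← approach-along w v∈B = x , x∈B , u ∷ xs , (e , u∉B) ∷ c

  approach : ∀ {u} → u ∈ V T → ∃ λ x → x ∈ V B × ∃ (Chain (OutEdge T B) u x)
  approach u∈T = approach-along (proj₂ (proj₁ tree) _ b₀ u∈T (proj₁ (proj₁ B⊑T) b₀ b₀∈B)) b₀∈B

  subtree-attachment : ∀ {A} → IsSubgraph A T → Attachment A B
  subtree-attachment {A} (_ , E-A⇒E-T) = record
    { anchor       = anchor
    ; anchor-fixed = anchor-fixed
    ; anchor-step  = anchor-step
    ; edge-induced = λ e u∈B v∈B →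
                       subtree-induced {T = T} (proj₂ tree) B⊑T u∈B v∈B (E-A⇒E-T _ _ e)
    }
    where
    anchor : Fin n → Fin n
    anchor u with u Subset.∈? V T
    ... | yes u∈T = proj₁ (approach u∈T)
    ... | no _    = u

    anchor-approach : ∀ {u} → u ∈ V T → anchor u ∈ V B × ∃ (Chain (OutEdge T B) u (anchor u))
    anchor-approach {u} u∈T′ with u Subset.∈? V T
    ... | yes u∈T = proj₂ (approach u∈T)
    ... | no u∉T  = ⊥-elim (u∉T u∈T′)

    anchor-fixed : ∀ {v} → v ∈ V B → anchor v ≡ v
    anchor-fixed v∈B =
      sym (approach-from-B T B v∈B (proj₂ (proj₂ (anchor-approach (proj₁ (proj₁ B⊑T) _ v∈B)))))

    anchor-step : ∀ {u v} → E A u v → u ∉ V B → anchor u ≡ anchor v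
    anchor-step e u∉B
      with e′ ← E-A⇒E-T _ _ e
      with u-anchor∈B , _ , u-approach ← anchor-approach (E-V T e′)
      with v-anchor∈B , _ , v-approach ← anchor-approach (E-V T (E-sym T e′)) =
      approach-unique {T = T} (proj₂ tree) B⊑T u-anchor∈B v-anchor∈B
                      u-approach ((e′ , u∉B) ∷ v-approach)

module Merge {n : ℕ} {A B : Graph n} (attachment : Attachment A B)
             (DA : PathDecomposition A) (DB : PathDecomposition B)
             (A≠∅ : Nonempty (V A)) (B≠∅ : Nonempty (V B)) where

  open Attachment attachment

  private
    p = len DA
    q = len DB

  -- The index of a bag of DB containing v; arbitrary when v ∉ B.
  B-bag : Fin n → Fin q
  B-bag v with v Subset.∈? V B
  ... | yes v∈B = proj₁ (vertex-cov DB v v∈B)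
  ... | no _    = proj₁ (vertex-cov DB _ (proj₂ B≠∅))

  ∈-B-bag : ∀ {v} → v ∈ V B → v ∈ bag DB (B-bag v)
  ∈-B-bag {v} v∈B′ with v Subset.∈? V B
  ... | yes v∈B = proj₂ (vertex-cov DB v v∈B)
  ... | no v∉B  = ⊥-elim (v∉B v∈B′)

  Hanging : Fin q → Fin n → Set
  Hanging j u = u ∉ V B × B-bag (anchor u) ≡ j

  hanging? : ∀ j → Decidable (Hanging j)
  hanging? j u = ¬? (u Subset.∈? V B) ×-dec (B-bag (anchor u) ≟ j)

  hanging : Fin q → Subset n
  hanging j = select (hanging? j)

  mergedBag : Fin q → Fin p → Subset n
  mergedBag j i = (bag DA i ∩ hanging j) ∪ bag DB j

  private
    i₀ : Fin p
    i₀ = proj₁ (vertex-cov DA _ (proj₂ A≠∅))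

    -- Pairs (j , i) in lexicographic order, encoded as Fin (q * p).
    bagAt : Fin (q * p) → Subset n
    bagAt t = mergedBag (quotient {q} p t) (remainder {q} p t)

    ∈-combine : ∀ {v j i} → v ∈ mergedBag j i → v ∈ bagAt (combine j i)
    ∈-combine {v} v∈ =
      subst (λ ji → v ∈ mergedBag (proj₁ ji) (proj₂ ji)) (sym (Finₚ.remQuot-combine _ _)) v∈

    ∈-A-part : ∀ {v j i} → v ∈ bag DA i → Hanging j v → v ∈ mergedBag j i
    ∈-A-part {j = j} v∈ h = Subset.x∈p∪q⁺ (inj₁ (Subset.x∈p∩q⁺ (v∈ , ∈-select⁺ (hanging? j) h)))

    ∈-B-part : ∀ {v j i} → v ∈ bag DB j → v ∈ mergedBag j i
    ∈-B-part v∈ = Subset.x∈p∪q⁺ (inj₂ v∈)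

    ∈-mergedBag⁻ : ∀ {v j i} → v ∈ mergedBag j i → (v ∈ bag DA i × Hanging j v) ⊎ v ∈ bag DB j
    ∈-mergedBag⁻ {j = j} {i} v∈ =
      Sum.map₁ (Product.map₂ (∈-select⁻ (hanging? j)) ∘ Subset.x∈p∩q⁻ (bag DA i) (hanging j))
               (Subset.x∈p∪q⁻ _ (bag DB j) v∈)

    ∈-mergedBag-B : ∀ {v j i} → v ∈ V B → v ∈ mergedBag j i → v ∈ bag DB j
    ∈-mergedBag-B v∈B v∈ with ∈-mergedBag⁻ v∈
    ... | inj₁ (_ , v∉B , _) = ⊥-elim (v∉B v∈B)
    ... | inj₂ v∈DB          = v∈DB

    ∈-mergedBag-A : ∀ {v j i} → v ∉ V B → v ∈ mergedBag j i → v ∈ bag DA i × Hanging j v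
    ∈-mergedBag-A v∉B v∈ with ∈-mergedBag⁻ v∈
    ... | inj₁ v∈DA-hanging = v∈DA-hanging
    ... | inj₂ v∈DB         = ⊥-elim (v∉B (bag⊆V DB _ _ v∈DB))

    within : ∀ t v → v ∈ bagAt t → v ∈ V (A ∪ᴳ B)
    within t v v∈ with ∈-mergedBag⁻ v∈
    ... | inj₁ (v∈DA , _) = Subset.x∈p∪q⁺ (inj₁ (bag⊆V DA _ v v∈DA))
    ... | inj₂ v∈DB       = Subset.x∈p∪q⁺ (inj₂ (bag⊆V DB _ v v∈DB))

    covers-vertex : ∀ v → v ∈ V (A ∪ᴳ B) → ∃ λ t → v ∈ bagAt t
    covers-vertex v v∈ with v Subset.∈? V B | Subset.x∈p∪q⁻ (V A) (V B) v∈
    ... | yes v∈B | _        = combine (B-bag v) i₀ , ∈-combine (∈-B-part (∈-B-bag v∈B))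
    ... | no v∉B  | inj₂ v∈B = ⊥-elim (v∉B v∈B)
    ... | no v∉B  | inj₁ v∈A with i , v∈DA ← vertex-cov DA v v∈A =
      combine (B-bag (anchor v)) i , ∈-combine (∈-A-part v∈DA (v∉B , refl))

    covers-B-edge : ∀ {u v} → E B u v → ∃ λ t → u ∈ bagAt t × v ∈ bagAt t
    covers-B-edge e with j , u∈ , v∈ ← edge-cov DB _ _ e =
      combine j i₀ , ∈-combine (∈-B-part u∈) , ∈-combine (∈-B-part v∈)

    covers-hanging-edge : ∀ {u v} → E A u v → u ∉ V B → ∃ λ t → u ∈ bagAt t × v ∈ bagAt t
    covers-hanging-edge {u} {v} e u∉B with i , u∈ , v∈ ← edge-cov DA _ _ e | v Subset.∈? V B
    ... | yes v∈B = combine (B-bag (anchor u)) i , ∈-combine (∈-A-part u∈ (u∉B , refl)) ,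
                    ∈-combine (∈-B-part (subst (λ x → v ∈ bag DB (B-bag x)) v≡anchor-u (∈-B-bag v∈B)))
      where
      v≡anchor-u : v ≡ anchor u
      v≡anchor-u = sym (trans (anchor-step e u∉B) (anchor-fixed v∈B))
    ... | no v∉B  = combine (B-bag (anchor u)) i , ∈-combine (∈-A-part u∈ (u∉B , refl)) ,
                    ∈-combine (∈-A-part v∈ (v∉B , cong B-bag (sym (anchor-step e u∉B))))

    covers-edge : ∀ u v → E (A ∪ᴳ B) u v → ∃ λ t → u ∈ bagAt t × v ∈ bagAt t
    covers-edge u v (inj₂ e) = covers-B-edge e
    covers-edge u v (inj₁ e) with u Subset.∈? V B | v Subset.∈? V B
    ... | no u∉B  | _        = covers-hanging-edge e u∉B
    ... | yes u∈B | yes v∈B  = covers-B-edge (edge-induced e u∈B v∈B)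
    ... | yes _   | no v∉B   = Product.map₂ Product.swap (covers-hanging-edge (E-sym A e) v∉B)

    contiguous : ∀ v (t₁ t₂ t₃ : Fin (q * p)) → t₁ ≤ᶠ t₂ → t₂ ≤ᶠ t₃ →
                 v ∈ bagAt t₁ → v ∈ bagAt t₃ → v ∈ bagAt t₂
    contiguous v t₁ t₂ t₃ t₁≤t₂ t₂≤t₃ v∈₁ v∈₃ with v Subset.∈? V B
    ... | yes v∈B = ∈-B-part (interval DB v _ _ _ (quotient-mono {q} p t₁≤t₂) (quotient-mono {q} p t₂≤t₃)
                                                (∈-mergedBag-B v∈B v∈₁) (∈-mergedBag-B v∈B v∈₃))
    ... | no v∉B
      with v∈DA₁ , _ , home≡q₁ ← ∈-mergedBag-A v∉B v∈₁
      with v∈DA₃ , _ , home≡q₃ ← ∈-mergedBag-A v∉B v∈₃ =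
      ∈-A-part (interval DA v _ _ _ (remainder-mono {q} p (sym q₂≡q₁) t₁≤t₂)
                                      (remainder-mono {q} p (trans q₂≡q₁ q₁≡q₃) t₂≤t₃) v∈DA₁ v∈DA₃)
               (v∉B , trans home≡q₁ (sym q₂≡q₁))
      where
      q₁≡q₃ : quotient {q} p t₁ ≡ quotient {q} p t₃
      q₁≡q₃ = trans (sym home≡q₁) home≡q₃
      q₂≡q₁ : quotient {q} p t₂ ≡ quotient {q} p t₁
      q₂≡q₁ = Finₚ.≤-antisym (subst (quotient {q} p t₂ ≤ᶠ_) (sym q₁≡q₃) (quotient-mono {q} p t₂≤t₃))
                             (quotient-mono {q} p t₁≤t₂)

  decomposition : PathDecomposition (A ∪ᴳ B)
  decomposition = record
    { len        = q * p
    ; bag        = bagAt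
    ; bag⊆V      = within
    ; edge-cov   = covers-edge
    ; vertex-cov = covers-vertex
    ; interval   = contiguous
    }

  mergedBag-size : ∀ j i → ∣ mergedBag j i ∣ ≤ maxBagSize DA + maxBagSize DB
  mergedBag-size j i = begin
    ∣ (bag DA i ∩ hanging j) ∪ bag DB j ∣  ≤⟨ ∣p∪q∣≤∣p∣+∣q∣ (bag DA i ∩ hanging j) (bag DB j) ⟩
    ∣ bag DA i ∩ hanging j ∣ + ∣ bag DB j ∣ ≤⟨ ℕ.+-monoˡ-≤ _ (Subset.∣p∩q∣≤∣p∣ (bag DA i) (hanging j)) ⟩
    ∣ bag DA i ∣ + ∣ bag DB j ∣             ≤⟨ ℕ.+-mono-≤ (bag≤maxBagSize DA i) (bag≤maxBagSize DB j) ⟩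
    maxBagSize DA + maxBagSize DB         ∎
    where open ℕ.≤-Reasoning

  decomposition-size : maxBagSize decomposition ≤ maxBagSize DA + maxBagSize DB
  decomposition-size = maxBagSize-lub decomposition λ t → mergedBag-size (quotient {q} p t) (remainder {q} p t)

record DecomposedSubtree {n : ℕ} (T : Graph n) : Set₁ where
  field
    graph         : Graph n
    subtree       : IsSubtree graph T
    decomposition : PathDecomposition graph

  size : ℕ
  size = maxBagSize decomposition

open DecomposedSubtree

module _ {n : ℕ} {T : Graph n} (tree : IsTree T) where

  private
    attachment : (P Q : DecomposedSubtree T) → Attachment (graph P) (graph Q)
    attachment P Q = subtree-attachment tree (subtree Q) (proj₁ (subtree P))

  merge : (P Q : DecomposedSubtree T) → ∀ {c} → c ∈ V (graph P) → c ∈ V (graph Q) → DecomposedSubtree T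
  merge P Q c∈P c∈Q = record
    { graph         = graph P ∪ᴳ graph Q
    ; subtree       = ∪ᴳ-least {G = graph P} {graph Q} {T} (proj₁ (subtree P)) (proj₁ (subtree Q)) ,
                      ∪ᴳ-connected (proj₂ (subtree P)) (proj₂ (subtree Q)) c∈P c∈Q
    ; decomposition =
        Merge.decomposition (attachment P Q) (decomposition P) (decomposition Q) (_ , c∈P) (_ , c∈Q)
    }

  merge-size : ∀ P Q {c} (c∈P : c ∈ V (graph P)) (c∈Q : c ∈ V (graph Q)) →
               size (merge P Q c∈P c∈Q) ≤ size P + size Q
  merge-size P Q c∈P c∈Q =
    Merge.decomposition-size (attachment P Q) (decomposition P) (decomposition Q) (_ , c∈P) (_ , c∈Q)

  private
    module _ {k} (Ps : Fin (suc (suc k)) → DecomposedSubtree T) (j : Fin (suc k)) {x}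
             (x∈P₀ : x ∈ V (graph (Ps zero))) (x∈Pⱼ : x ∈ V (graph (Ps (suc j)))) where

      merged : DecomposedSubtree T
      merged = merge (Ps zero) (Ps (suc j)) x∈P₀ x∈Pⱼ

      merge-into : Fin (suc k) → DecomposedSubtree T
      merge-into = updateAt (Ps ∘ suc) j (λ _ → merged)

      merge-into-covers : CoveredBy T (graph ∘ Ps) → CoveredBy T (graph ∘ merge-into)
      merge-into-covers = coveredBy-⊆ {G = T} {graph ∘ Ps} {graph ∘ merge-into}
        (λ { zero → j ; (suc i) → i })
        (λ { zero    → into-merged {graph (Ps zero)} (∪ᴳ-subgraphˡ {G = graph (Ps zero)} {graph (Ps (suc j))})
           ; (suc i) → piece⊆ i (i ≟ j)
           })
        where
        into-merged : ∀ {G} → IsSubgraph G (graph merged) → IsSubgraph G (graph (merge-into j))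
        into-merged {G} = subst (λ P → IsSubgraph G (graph P)) (sym (Vectorₚ.updateAt-updates j (Ps ∘ suc)))

        piece⊆ : ∀ i → Dec (i ≡ j) → IsSubgraph (graph (Ps (suc i))) (graph (merge-into i))
        piece⊆ i (yes refl) =
          into-merged {graph (Ps (suc j))} (∪ᴳ-subgraphʳ {G = graph (Ps zero)} {graph (Ps (suc j))})
        piece⊆ i (no i≢j)   =
          subst (λ P → IsSubgraph (graph (Ps (suc i))) (graph P))
                (sym (Vectorₚ.updateAt-minimal i j (Ps ∘ suc) i≢j)) (IsSubgraph-refl {G = graph (Ps (suc i))})

      merge-into-size : sum (tabulate (size ∘ merge-into)) ≤ sum (tabulate (size ∘ Ps))
      merge-into-size = sum-tabulate-updateAt-≤ size (Ps ∘ suc) j (λ _ → merged) (size (Ps zero))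
                          (merge-size (Ps zero) (Ps (suc j)) x∈P₀ x∈Pⱼ)

  cover-decomposition : ∀ {k} (Ps : Fin (suc k) → DecomposedSubtree T) → CoveredBy T (graph ∘ Ps) →
                        Σ (PathDecomposition T) λ D → maxBagSize D ≤ sum (tabulate (size ∘ Ps))
  cover-decomposition {zero} Ps covered =
    spanning-supergraph-decomposition (proj₁ (proj₁ (subtree (Ps zero))))
      (sole-piece {G = T} {graph ∘ Ps} covered) (decomposition (Ps zero)) ,
    ℕ.m≤m+n _ 0
  cover-decomposition {suc k} Ps covered
    with j , x , x∈P₀ , x∈Pⱼ ← overlapping-piece (graph ∘ Ps) (proj₁ tree) (proj₁ ∘ subtree ∘ Ps)
                                 (proj₁ ∘ proj₂ ∘ subtree ∘ Ps) covered
    with D , D≤ ← cover-decomposition (merge-into Ps j x∈P₀ x∈Pⱼ)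
                                      (merge-into-covers Ps j x∈P₀ x∈Pⱼ covered) =
    D , ℕ.≤-trans D≤ (merge-into-size Ps j x∈P₀ x∈Pⱼ)

corollary8 : ∀ {n k} (T : Graph n) (Ts : Fin k → Graph n) →
    IsTree T → (∀ i → IsSubtree (Ts i) T) → CoveredBy T Ts →
    (p : ℕ) (ps : Fin k → ℕ) →
    IsPathwidth T p → (∀ i → IsPathwidth (Ts i) (ps i)) →
    p + 1 ≤ sum (tabulate (λ i → ps i + 1))
corollary8 {k = zero} T Ts tree _ (V-covered , _) _ _ _ _ with V-covered _ (proj₂ (proj₁ (proj₁ tree)))
... | () , _
corollary8 {k = suc k} T Ts tree subtrees covered p ps (_ , p-minimal) pw-Ts = begin
    p + 1                            ≤⟨ ℕ.+-monoˡ-≤ 1 (p-minimal D) ⟩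
    width D + 1                      ≤⟨ m∸n+n≤m⊔n (maxBagSize D) 1 ⟩
    maxBagSize D ⊔ 1                 ≤⟨ ℕ.⊔-lub (ℕ.≤-trans D≤ (sum-tabulate-mono size≤)) 1≤ ⟩
    sum (tabulate (λ i → ps i + 1))  ∎
  where
  open ℕ.≤-Reasoning

  pieces : Fin (suc k) → DecomposedSubtree T
  pieces i = record { graph = Ts i ; subtree = subtrees i ; decomposition = proj₁ (proj₁ (pw-Ts i)) }

  D : PathDecomposition T
  D = proj₁ (cover-decomposition tree pieces covered)

  D≤ : maxBagSize D ≤ sum (tabulate (size ∘ pieces))
  D≤ = proj₂ (cover-decomposition tree pieces covered)

  size≤ : ∀ i → size (pieces i) ≤ ps i + 1
  size≤ i = subst (λ w → size (pieces i) ≤ w + 1) (proj₂ (proj₁ (pw-Ts i)))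
                  (maxBagSize≤width+1 (proj₁ (proj₁ (pw-Ts i))))

  1≤ : 1 ≤ sum (tabulate (λ i → ps i + 1))
  1≤ = ℕ.≤-trans (ℕ.m≤n+m 1 (ps zero)) (ℕ.m≤m+n _ _)
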